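{- Let $m\geq 1$ and let $5\leq p_1<\cdots<p_m$ be distinct primes. Then the $m$-fold (common) non-ranks of $p_1,\ldots,p_m$ form $2^m$ arithmetic progressions with common difference $2p_1\cdots p_m$: there are exactly $2^m$ distinct residue classes modulo $2p_1\cdots p_m$ such that, for all sufficiently large integers $t$, $t$ is a non-rank of every $p_i$ if and only if $t$ lies in one of these classes.
   Context: For real $x$, $N(x)$ is the integer nearest to $x$. For a prime $q\geq 5$, the non-ranks of $q$ are the integers $(2n+1)q+4N(q/6)$ with $n\geq 0$ and $(2n+1)q-4N(q/6)$ with $n\geq 1$. -}

module Defs where

open import Data.Nat using (ℕ; zero; suc; _*_; _/_; _≥_; NonZero)
import Data.Nat as N
open import Data.Fin using (Fin)
open import Data.Integer as ℤ using (ℤ; +_)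
open import Data.Product using (∃; _×_)
open import Data.Sum using (_⊎_)
open import Relation.Binary.PropositionalEquality using (_≡_)

-- Nearest integer N(a/b) to the nonnegative rational a/b (b > 0):
-- N(a/b) = ⌊ a/b + 1/2 ⌋ = ⌊ (2a + b) / (2b) ⌋   (ties rounded up; for a
-- prime q ≥ 5, q/6 is never a tie since q ≢ 3 mod 6).
nearest : (a b : ℕ) → .{{NonZero b}} → ℕ
nearest a (suc b) = (2 * a N.+ suc b) / (2 * suc b)

NonRank : ℕ → ℤ → Set
NonRank q t =
  (∃ λ (n : ℕ) → t ≡ (+ ((2 * n N.+ 1) * q)) ℤ.+ (+ (4 * nearest q 6)))
  ⊎ (∃ λ (n : ℕ) → n ≥ 1 × t ≡ (+ ((2 * n N.+ 1) * q)) ℤ.- (+ (4 * nearest q 6)))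

prodFin : (m : ℕ) → (Fin m → ℕ) → ℕ
prodFin zero p = 1
prodFin (suc m) p = p Fin.zero * prodFin m (λ i → p (Fin.suc i))
  where import Data.Fin as Fin

-- For a prime q ≥ 5 put c = 4N(q/6); c is even and 0 < c < q. For t ≥ q, t is a non-rank of q
-- exactly when t is odd and t ≡ ±c (mod q): writing t ∓ c = kq with q odd, the oddness of t forces
-- k to be odd, and t ≥ q rules out k = 1 in the case t + c = kq. As 2, p₁, …, pₘ are pairwise
-- coprime and c ≢ −c (mod pᵢ), the Chinese remainder theorem turns these conditions into 2^m
-- distinct classes modulo 2p₁⋯pₘ, obtained by lifting the class of 1 mod 2 one prime at a time.
module Submission where

open import Defs
open import Data.Nat using (ℕ; zero; suc; _+_; _*_; _∸_; _^_; _<_; _≤_; _≥_; NonZero; >-nonZero; z≤n; s≤s; s<s)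
open import Data.Nat.Properties as ℕₚ
  using (≤-refl; ≤-trans; ≤-<-trans; <⇒≤; <⇒≱; ≤-total; ≤-antisym; m≤n+m; m≤n*m; m+n∸n≡m; m∸n+n≡m;
         m∸n≤m; m∸n≡0⇒m≤n; m*n≢0; +-comm)
open import Data.Nat.Divisibility
  using (_∤_; divides; ∣-refl; ∣-trans; ∣⇒≤; ∣1⇒≡1; _∣0; m∣m*n; n∣m*n; ∣m⇒∣m*n; ∣m∣n⇒∣m+n;
         ∣m+n∣m⇒∣n; ∣m∸n∣n⇒∣m)
  renaming (_∣_ to _∣ℕ_)
open import Data.Nat.DivMod using (m/n*n≤m; m≥n⇒m/n>0)
open import Data.Nat.Coprimality as Coprimality
  using (Coprime; coprime-Bézout; coprime-divisor; coprime⇒gcd≡1; prime⇒coprime)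
open import Data.Nat.GCD using (gcd; module Bézout)
open import Data.Nat.LCM using (lcm; lcm-least; gcd*lcm)
open import Data.Nat.Primality using (Prime; euclidsLemma; prime[2]; prime⇒nonZero)
import Data.Nat.Tactic.RingSolver as ℕ-Ring
open import Data.Fin using (Fin)
import Data.Fin as F
open import Data.Integer as ℤ using (ℤ; +_)
open import Data.Integer.Properties as ℤₚ using (+-injective; pos-*; [+m]-[+n]≡m⊖n; ⊖-≥)
open import Data.Integer.DivMod using (_%ℕ_; _/ℕ_; n%ℕd<d; a≡a%ℕn+[a/ℕn]*n)
open import Data.Integer.Divisibility using (_∣_)
open import Data.Integer.Divisibility.Signed as Signed using (∣ᵤ⇒∣; ∣⇒∣ᵤ) renaming (_∣_ to _∣ₛ_)
import Data.Integer.Tactic.RingSolver as ℤ-Ring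
open import Data.List using (List; []; _∷_; length)
open import Data.List.Relation.Unary.All as All using (All; []; _∷_)
open import Data.List.Relation.Unary.All.Properties using (¬Any⇒All¬)
open import Data.List.Relation.Unary.AllPairs using ([]; _∷_)
open import Data.List.Relation.Unary.Any using (here; there)
open import Data.List.Relation.Unary.Unique.Propositional using (Unique)
open import Data.List.Membership.Propositional using (_∈_)
open import Data.Product using (Σ; ∃; ∃₂; _×_; _,_; proj₁; proj₂; map₂)
open import Data.Product.Function.NonDependent.Propositional using (_×-⇔_)
open import Data.Sum as Sum using (_⊎_; inj₁; inj₂; [_,_])
open import Data.Sum.Function.Propositional using (_⊎-⇔_)
open import Function using (_∘_)
open import Function.Bundles using (_⇔_; mk⇔; Equivalence)
import Function.Properties.Equivalence as ⇔
open import Relation.Binary.PropositionalEquality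
  using (_≡_; _≢_; refl; sym; trans; cong; cong₂; subst; module ≡-Reasoning)
open import Relation.Nullary using (¬_; contradiction)

infix 4 _≡_mod_

-- A record rather than a synonym, so that a, b and n can be inferred from a congruence.
record _≡_mod_ (a b : ℤ) (n : ℕ) : Set where
  constructor mk≡mod
  field
    ∣-difference : + n ∣ₛ a ℤ.- b

open _≡_mod_ using (∣-difference)

≡-mod⇔∣ : ∀ {n a b} → a ≡ b mod n ⇔ + n ∣ a ℤ.- b
≡-mod⇔∣ = mk⇔ (∣⇒∣ᵤ ∘ ∣-difference) (mk≡mod ∘ ∣ᵤ⇒∣)

≡-mod-sym : ∀ {n a b} → a ≡ b mod n → b ≡ a mod n
≡-mod-sym {n} {a} {b} (mk≡mod n∣a-b) = mk≡mod (subst (+ n ∣ₛ_) (negate-difference a b) (Signed.∣m⇒∣-m n∣a-b))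
  where
  negate-difference : ∀ a b → ℤ.- (a ℤ.- b) ≡ b ℤ.- a
  negate-difference = ℤ-Ring.solve-∀

≡-mod-trans : ∀ {n a b c} → a ≡ b mod n → b ≡ c mod n → a ≡ c mod n
≡-mod-trans {n} {a} {b} {c} (mk≡mod n∣a-b) (mk≡mod n∣b-c) =
  mk≡mod (subst (+ n ∣ₛ_) (telescope a b c) (Signed.∣m∣n⇒∣m+n n∣a-b n∣b-c))
  where
  telescope : ∀ a b c → (a ℤ.- b) ℤ.+ (b ℤ.- c) ≡ a ℤ.- c
  telescope = ℤ-Ring.solve-∀

≡-mod-∣ : ∀ {m n a b} → m ∣ℕ n → a ≡ b mod n → a ≡ b mod m
≡-mod-∣ m∣n (mk≡mod n∣a-b) = mk≡mod (Signed.∣-trans (∣ᵤ⇒∣ m∣n) n∣a-b)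

coprime⇒*∣ : ∀ {m n k} → Coprime m n → m ∣ℕ k → n ∣ℕ k → m * n ∣ℕ k
coprime⇒*∣ {m} {n} m⊥n m∣k n∣k = subst (_∣ℕ _) lcm≡m*n (lcm-least m∣k n∣k)
  where
  open ≡-Reasoning
  lcm≡m*n : lcm m n ≡ m * n
  lcm≡m*n = begin
    lcm m n           ≡⟨ ℕₚ.*-identityˡ (lcm m n) ⟨
    1 * lcm m n       ≡⟨ cong (_* lcm m n) (coprime⇒gcd≡1 m⊥n) ⟨
    gcd m n * lcm m n ≡⟨ gcd*lcm m n ⟩
    m * n             ∎

≡-mod-combine : ∀ {m n a b} → Coprime m n → a ≡ b mod m → a ≡ b mod n → a ≡ b mod m * n
≡-mod-combine m⊥n (mk≡mod m∣a-b) (mk≡mod n∣a-b) = mk≡mod (∣ᵤ⇒∣ (coprime⇒*∣ m⊥n (∣⇒∣ᵤ m∣a-b) (∣⇒∣ᵤ n∣a-b)))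

+m-+n≡+[m∸n] : ∀ {m n} → n ≤ m → + m ℤ.- + n ≡ + (m ∸ n)
+m-+n≡+[m∸n] {m} {n} n≤m = trans ([+m]-[+n]≡m⊖n m n) (⊖-≥ n≤m)

∣∸⇔≡-mod : ∀ {q u c} → c ≤ u → q ∣ℕ u ∸ c ⇔ + u ≡ + c mod q
∣∸⇔≡-mod {q} c≤u = mk⇔
  (mk≡mod ∘ subst (+ q ∣ₛ_) (sym (+m-+n≡+[m∸n] c≤u)) ∘ ∣ᵤ⇒∣)
  (∣⇒∣ᵤ ∘ subst (+ q ∣ₛ_) (+m-+n≡+[m∸n] c≤u) ∘ ∣-difference)

∣+⇔≡-mod : ∀ {q u c} → q ∣ℕ u + c ⇔ + u ≡ ℤ.- + c mod q
∣+⇔≡-mod {q} {u} {c} = mk⇔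
  (mk≡mod ∘ subst (+ q ∣ₛ_) (sym u--c≡u+c) ∘ ∣ᵤ⇒∣)
  (∣⇒∣ᵤ ∘ subst (+ q ∣ₛ_) u--c≡u+c ∘ ∣-difference)
  where
  u--c≡u+c : + u ℤ.- ℤ.- + c ≡ + (u + c)
  u--c≡u+c = cong (ℤ._+_ (+ u)) (ℤₚ.neg-involutive (+ c))

∣∧<⇒≡0 : ∀ {n k} → n ∣ℕ k → k < n → k ≡ 0
∣∧<⇒≡0 {k = zero}  _   _   = refl
∣∧<⇒≡0 {k = suc k} n∣k k<n = contradiction (∣⇒≤ n∣k) (<⇒≱ k<n)

≡-mod⇒≡-≥ : ∀ {n r s} → s ≤ r → r < n → + r ≡ + s mod n → r ≡ s
≡-mod⇒≡-≥ {n} {r} {s} s≤r r<n r≡s = ≤-antisym (m∸n≡0⇒m≤n r∸s≡0) s≤r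
  where
  r∸s≡0 : r ∸ s ≡ 0
  r∸s≡0 = ∣∧<⇒≡0 (Equivalence.from (∣∸⇔≡-mod s≤r) r≡s) (≤-<-trans (m∸n≤m r s) r<n)

≡-mod⇒≡ : ∀ {n r s} → r < n → s < n → + r ≡ + s mod n → r ≡ s
≡-mod⇒≡ {n} {r} {s} r<n s<n r≡s with ≤-total s r
... | inj₁ s≤r = ≡-mod⇒≡-≥ s≤r r<n r≡s
... | inj₂ r≤s = sym (≡-mod⇒≡-≥ r≤s s<n (≡-mod-sym r≡s))

%ℕ-≡-mod : ∀ a n .{{_ : NonZero n}} → + (a %ℕ n) ≡ a mod n
%ℕ-≡-mod a n = mk≡mod (Signed.divides (ℤ.- (a /ℕ n)) (begin
  + r ℤ.- a                              ≡⟨ cong (ℤ._-_ (+ r)) (a≡a%ℕn+[a/ℕn]*n a n) ⟩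
  + r ℤ.- (+ r ℤ.+ a /ℕ n ℤ.* + n)       ≡⟨ cancel (+ r) (a /ℕ n) (+ n) ⟩
  ℤ.- (a /ℕ n) ℤ.* + n                   ∎))
  where
  open ≡-Reasoning
  r : ℕ
  r = a %ℕ n
  cancel : ∀ r q n → r ℤ.- (r ℤ.+ q ℤ.* n) ≡ ℤ.- q ℤ.* n
  cancel = ℤ-Ring.solve-∀

ℕ-bézout⇒ℤ : ∀ x y m n → 1 + y * n ≡ x * m → + x ℤ.* + m ℤ.- + y ℤ.* + n ≡ + 1
ℕ-bézout⇒ℤ x y m n eq = begin
  + x ℤ.* + m ℤ.- + y ℤ.* + n       ≡⟨ cong₂ ℤ._-_ (pos-* x m) (pos-* y n) ⟨
  + (x * m) ℤ.- + (y * n)           ≡⟨ cong (λ k → + k ℤ.- + (y * n)) eq ⟨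
  + 1 ℤ.+ + (y * n) ℤ.- + (y * n)   ≡⟨ cancel (+ 1) (+ (y * n)) ⟩
  + 1                               ∎
  where
  open ≡-Reasoning
  cancel : ∀ a b → a ℤ.+ b ℤ.- b ≡ a
  cancel = ℤ-Ring.solve-∀

bézout : ∀ {m n} → Coprime m n → ∃₂ λ α β → α ℤ.* + m ℤ.+ β ℤ.* + n ≡ + 1
bézout {m} {n} m⊥n with coprime-Bézout m⊥n
... | Bézout.+- x y 1+yn≡xm =
  + x , ℤ.- + y , trans (reorder (+ x) (+ m) (+ y) (+ n)) (ℕ-bézout⇒ℤ x y m n 1+yn≡xm)
  where
  reorder : ∀ a b c d → a ℤ.* b ℤ.+ ℤ.- c ℤ.* d ≡ a ℤ.* b ℤ.- c ℤ.* d
  reorder = ℤ-Ring.solve-∀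
... | Bézout.-+ x y 1+xm≡yn =
  ℤ.- + x , + y , trans (reorder (+ x) (+ m) (+ y) (+ n)) (ℕ-bézout⇒ℤ y x n m 1+xm≡yn)
  where
  reorder : ∀ a b c d → ℤ.- a ℤ.* b ℤ.+ c ℤ.* d ≡ c ℤ.* d ℤ.- a ℤ.* b
  reorder = ℤ-Ring.solve-∀

bézout-combination-≡ : ∀ {m n} α β a b → α ℤ.* + m ℤ.+ β ℤ.* + n ≡ + 1 →
                       a ℤ.* (β ℤ.* + n) ℤ.+ b ℤ.* (α ℤ.* + m) ≡ a mod m
bézout-combination-≡ {m} {n} α β a b αm+βn≡1 = mk≡mod (Signed.divides ((b ℤ.- a) ℤ.* α) (begin
  x ℤ.- a                                      ≡⟨ cong (ℤ._-_ x) (ℤₚ.*-identityʳ a) ⟨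
  x ℤ.- a ℤ.* + 1                              ≡⟨ cong (λ e → x ℤ.- a ℤ.* e) αm+βn≡1 ⟨
  x ℤ.- a ℤ.* (α ℤ.* + m ℤ.+ β ℤ.* + n)        ≡⟨ expand a b α β (+ m) (+ n) ⟩
  (b ℤ.- a) ℤ.* α ℤ.* + m                      ∎))
  where
  open ≡-Reasoning
  x : ℤ
  x = a ℤ.* (β ℤ.* + n) ℤ.+ b ℤ.* (α ℤ.* + m)
  expand : ∀ a b α β m n →
    a ℤ.* (β ℤ.* n) ℤ.+ b ℤ.* (α ℤ.* m) ℤ.- a ℤ.* (α ℤ.* m ℤ.+ β ℤ.* n) ≡ (b ℤ.- a) ℤ.* α ℤ.* m
  expand = ℤ-Ring.solve-∀

-- Opaque, as unfolding it makes unification normalise the Bézout computation.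
opaque
  crt : ∀ {m n} .{{_ : NonZero (m * n)}} → Coprime m n → (a b : ℤ) →
        ∃ λ x → x < m * n × + x ≡ a mod m × + x ≡ b mod n
  crt {m} {n} m⊥n a b with bézout m⊥n
  ... | α , β , αm+βn≡1 =
    x %ℕ (m * n) , n%ℕd<d x (m * n) ,
    ≡-mod-trans (≡-mod-∣ (m∣m*n n) (%ℕ-≡-mod x (m * n))) (bézout-combination-≡ α β a b αm+βn≡1) ,
    ≡-mod-trans (≡-mod-∣ (n∣m*n m) (%ℕ-≡-mod x (m * n)))
      (subst (λ y → y ≡ b mod n) (ℤₚ.+-comm (b ℤ.* (α ℤ.* + m)) (a ℤ.* (β ℤ.* + n)))
        (bézout-combination-≡ β α b a (trans (ℤₚ.+-comm (β ℤ.* + n) (α ℤ.* + m)) αm+βn≡1)))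
    where
    x : ℤ
    x = a ℤ.* (β ℤ.* + n) ℤ.+ b ℤ.* (α ℤ.* + m)

record ResidueClasses (n k : ℕ) (P : ℤ → Set) : Set where
  field
    residues         : List ℕ
    length-residues  : length residues ≡ k
    residues-unique  : Unique residues
    residues-<       : All (_< n) residues
    characterisation : ∀ t → P t ⇔ (∃ λ r → r ∈ residues × t ≡ + r mod n)

ResidueClasses-resp : ∀ {n n′ k P Q} → n ≡ n′ → (∀ t → P t ⇔ Q t) →
                      ResidueClasses n k P → ResidueClasses n′ k Q
ResidueClasses-resp refl P⇔Q S = record
  { residues         = residues
  ; length-residues  = length-residues
  ; residues-unique  = residues-unique
  ; residues-<       = residues-<
  ; characterisation = λ t → ⇔.trans (⇔.sym (P⇔Q t)) (characterisation t)
  }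
  where open ResidueClasses S

singleton-class : ∀ {n r} → r < n → ResidueClasses n 1 (λ t → t ≡ + r mod n)
singleton-class {r = r} r<n = record
  { residues         = r ∷ []
  ; length-residues  = refl
  ; residues-unique  = [] ∷ []
  ; residues-<       = r<n ∷ []
  ; characterisation = λ t → mk⇔ (λ t≡r → r , here refl , t≡r) λ { (_ , here refl , t≡r) → t≡r }
  }

module Lift {m n : ℕ} .{{_ : NonZero (m * n)}} (m⊥n : Coprime m n)
            {a b : ℤ} (a≢b : ¬ a ≡ b mod n) where

  lift : ℕ → ℤ → ℕ
  lift r s = proj₁ (crt m⊥n (+ r) s)

  lift-< : ∀ r s → lift r s < m * n
  lift-< r s = proj₁ (proj₂ (crt m⊥n (+ r) s))

  lift-≡ₘ : ∀ r s → + lift r s ≡ + r mod m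
  lift-≡ₘ r s = proj₁ (proj₂ (proj₂ (crt m⊥n (+ r) s)))

  lift-≡ₙ : ∀ r s → + lift r s ≡ s mod n
  lift-≡ₙ r s = proj₂ (proj₂ (proj₂ (crt m⊥n (+ r) s)))

  ≡-lift⇔ : ∀ {t r s} → (t ≡ + r mod m × t ≡ s mod n) ⇔ t ≡ + lift r s mod m * n
  ≡-lift⇔ {t} {r} {s} = mk⇔
    (λ (t≡r , t≡s) → ≡-mod-combine m⊥n (≡-mod-trans t≡r (≡-mod-sym (lift-≡ₘ r s)))
                                       (≡-mod-trans t≡s (≡-mod-sym (lift-≡ₙ r s))))
    (λ t≡y → ≡-mod-trans (≡-mod-∣ (m∣m*n n) t≡y) (lift-≡ₘ r s) ,
             ≡-mod-trans (≡-mod-∣ (n∣m*n m) t≡y) (lift-≡ₙ r s))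

  lift-injective : ∀ {r r′ s s′} → r < m → r′ < m → lift r s ≡ lift r′ s′ → r ≡ r′
  lift-injective {r} {r′} {s} {s′} r<m r′<m eq = ≡-mod⇒≡ r<m r′<m
    (≡-mod-trans (≡-mod-sym (lift-≡ₘ r s)) (subst (λ y → + y ≡ + r′ mod m) (sym eq) (lift-≡ₘ r′ s′)))

  lift-separates : ∀ r → lift r a ≢ lift r b
  lift-separates r eq =
    a≢b (≡-mod-trans (≡-mod-sym (lift-≡ₙ r a)) (subst (λ y → + y ≡ b mod n) (sym eq) (lift-≡ₙ r b)))

  lifts : List ℕ → List ℕ
  lifts []       = []
  lifts (r ∷ rs) = lift r a ∷ lift r b ∷ lifts rs

  length-lifts : ∀ rs → length (lifts rs) ≡ 2 * length rs
  length-lifts []       = refl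
  length-lifts (r ∷ rs) = trans (cong (suc ∘ suc) (length-lifts rs)) (sym (ℕₚ.*-distribˡ-+ 2 1 (length rs)))

  lifts-< : ∀ rs → All (_< m * n) (lifts rs)
  lifts-< []       = []
  lifts-< (r ∷ rs) = lift-< r a ∷ lift-< r b ∷ lifts-< rs

  ∈-lifts⁺ : ∀ {r s rs} → r ∈ rs → s ≡ a ⊎ s ≡ b → lift r s ∈ lifts rs
  ∈-lifts⁺ (here refl)  (inj₁ refl) = here refl
  ∈-lifts⁺ (here refl)  (inj₂ refl) = there (here refl)
  ∈-lifts⁺ (there r∈rs) s∈ab        = there (there (∈-lifts⁺ r∈rs s∈ab))

  ∈-lifts⁻ : ∀ {y rs} → y ∈ lifts rs → ∃₂ λ r s → r ∈ rs × (s ≡ a ⊎ s ≡ b) × y ≡ lift r s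
  ∈-lifts⁻ {rs = r ∷ rs} (here y≡)          = r , a , here refl , inj₁ refl , y≡
  ∈-lifts⁻ {rs = r ∷ rs} (there (here y≡))  = r , b , here refl , inj₂ refl , y≡
  ∈-lifts⁻ {rs = r ∷ rs} (there (there y∈)) with ∈-lifts⁻ y∈
  ... | r′ , s , r′∈rs , s∈ab , y≡ = r′ , s , there r′∈rs , s∈ab , y≡

  lift-fresh : ∀ {r s rs} → r < m → All (_< m) rs → All (r ≢_) rs → All (lift r s ≢_) (lifts rs)
  lift-fresh {rs = rs} r<m rs<m r∉rs = ¬Any⇒All¬ (lifts rs) λ lift∈ →
    let r′ , _ , r′∈rs , _ , eq = ∈-lifts⁻ lift∈
    in All.lookup r∉rs r′∈rs (lift-injective r<m (All.lookup rs<m r′∈rs) eq)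

  lifts-unique : ∀ {rs} → All (_< m) rs → Unique rs → Unique (lifts rs)
  lifts-unique {[]}     []           []                = []
  lifts-unique {r ∷ rs} (r<m ∷ rs<m) (r∉rs ∷ rs-unique) =
    (lift-separates r ∷ lift-fresh r<m rs<m r∉rs) ∷ lift-fresh r<m rs<m r∉rs ∷ lifts-unique rs<m rs-unique

  lift-classes : ∀ {k P} → ResidueClasses m k P →
                 ResidueClasses (m * n) (2 * k) (λ t → P t × (t ≡ a mod n ⊎ t ≡ b mod n))
  lift-classes {P = P} S = record
    { residues         = lifts residues
    ; length-residues  = trans (length-lifts residues) (cong (2 *_) length-residues)
    ; residues-unique  = lifts-unique residues-< residues-unique
    ; residues-<       = lifts-< residues
    ; characterisation = λ t → mk⇔ to from
    }
    where
    open ResidueClasses S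
    to : ∀ {t} → P t × (t ≡ a mod n ⊎ t ≡ b mod n) → ∃ λ y → y ∈ lifts residues × t ≡ + y mod m * n
    to {t} (Pt , t≡a⊎b) with Equivalence.to (characterisation t) Pt
    ... | r , r∈ , t≡r = [ (λ t≡a → lift r a , ∈-lifts⁺ r∈ (inj₁ refl) , Equivalence.to ≡-lift⇔ (t≡r , t≡a))
                         , (λ t≡b → lift r b , ∈-lifts⁺ r∈ (inj₂ refl) , Equivalence.to ≡-lift⇔ (t≡r , t≡b)) ] t≡a⊎b
    from : ∀ {t} → (∃ λ y → y ∈ lifts residues × t ≡ + y mod m * n) → P t × (t ≡ a mod n ⊎ t ≡ b mod n)
    from {t} (y , y∈ , t≡y) with ∈-lifts⁻ y∈
    ... | r , s , r∈ , s∈ab , refl with Equivalence.from ≡-lift⇔ t≡y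
    ...   | t≡r , t≡s =
      Equivalence.from (characterisation t) (r , r∈ , t≡r) ,
      Sum.map (λ { refl → t≡s }) (λ { refl → t≡s }) s∈ab

prodFin-nonZero : ∀ m (p : Fin m → ℕ) → (∀ i → NonZero (p i)) → NonZero (prodFin m p)
prodFin-nonZero zero    p p≢0 = _
prodFin-nonZero (suc m) p p≢0 =
  m*n≢0 (p F.zero) _ {{p≢0 F.zero}} {{prodFin-nonZero m (p ∘ F.suc) (p≢0 ∘ F.suc)}}

∣-prodFin : ∀ m (p : Fin m → ℕ) i → p i ∣ℕ prodFin m p
∣-prodFin (suc m) p F.zero    = m∣m*n _
∣-prodFin (suc m) p (F.suc i) = ∣-trans (∣-prodFin m (p ∘ F.suc) i) (n∣m*n (p F.zero))

coprime-*ˡ : ∀ {m n o} → Coprime m o → Coprime n o → Coprime (m * n) o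
coprime-*ˡ {m} {o = o} m⊥o n⊥o {d} (d∣mn , d∣o) = n⊥o (coprime-divisor d⊥m d∣mn , d∣o)
  where
  d⊥m : Coprime d m
  d⊥m (e∣d , e∣m) = m⊥o (e∣m , ∣-trans e∣d d∣o)

coprime-prodFin : ∀ m (p : Fin m → ℕ) {o} → (∀ i → Coprime (p i) o) → Coprime (prodFin m p) o
coprime-prodFin zero    p p⊥o (d∣1 , _) = ∣1⇒≡1 d∣1
coprime-prodFin (suc m) p p⊥o = coprime-*ˡ (p⊥o F.zero) (coprime-prodFin m (p ∘ F.suc) (p⊥o ∘ F.suc))

crt-classes : ∀ m (p : Fin m → ℕ) (a b : Fin m → ℤ) {n₀ r₀} .{{_ : NonZero n₀}} → r₀ < n₀ →
  (∀ i → NonZero (p i)) → (∀ i → Coprime n₀ (p i)) → (∀ i j → i F.< j → Coprime (p i) (p j)) →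
  (∀ i → ¬ a i ≡ b i mod p i) →
  ResidueClasses (n₀ * prodFin m p) (2 ^ m)
    (λ t → t ≡ + r₀ mod n₀ × (∀ i → t ≡ a i mod p i ⊎ t ≡ b i mod p i))
crt-classes zero p a b {n₀} r₀<n₀ _ _ _ _ =
  ResidueClasses-resp (sym (ℕₚ.*-identityʳ n₀)) (λ t → mk⇔ (_, λ ()) proj₁) (singleton-class r₀<n₀)
crt-classes (suc m) p a b {n₀} {r₀} r₀<n₀ p≢0 n₀⊥p p⊥p a≢b =
  ResidueClasses-resp modulus-reassociates (λ t → mk⇔ regroup ungroup)
    (Lift.lift-classes n₀Q⊥p₀ (a≢b F.zero)
      (crt-classes m (p ∘ F.suc) (a ∘ F.suc) (b ∘ F.suc) r₀<n₀ (p≢0 ∘ F.suc) (n₀⊥p ∘ F.suc)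
        (λ i j i<j → p⊥p (F.suc i) (F.suc j) (s<s i<j)) (a≢b ∘ F.suc)))
  where
  Q : ℕ
  Q = prodFin m (p ∘ F.suc)
  instance
    Q≢0 : NonZero Q
    Q≢0 = prodFin-nonZero m (p ∘ F.suc) (p≢0 ∘ F.suc)
    n₀Qp₀≢0 : NonZero (n₀ * Q * p F.zero)
    n₀Qp₀≢0 = m*n≢0 (n₀ * Q) (p F.zero) {{m*n≢0 n₀ Q}} {{p≢0 F.zero}}
  n₀Q⊥p₀ : Coprime (n₀ * Q) (p F.zero)
  n₀Q⊥p₀ = coprime-*ˡ (n₀⊥p F.zero)
    (coprime-prodFin m (p ∘ F.suc) λ i → Coprimality.sym (p⊥p F.zero (F.suc i) (s≤s z≤n)))
  modulus-reassociates : n₀ * Q * p F.zero ≡ n₀ * prodFin (suc m) p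
  modulus-reassociates = trans (ℕₚ.*-assoc n₀ Q (p F.zero)) (cong (n₀ *_) (ℕₚ.*-comm Q (p F.zero)))
  Congruent : ℤ → Fin (suc m) → Set
  Congruent t i = t ≡ a i mod p i ⊎ t ≡ b i mod p i
  regroup : ∀ {t} → (t ≡ + r₀ mod n₀ × (∀ i → Congruent t (F.suc i))) × Congruent t F.zero →
            t ≡ + r₀ mod n₀ × (∀ i → Congruent t i)
  regroup ((t≡r₀ , congruent-tail) , congruent₀) = t≡r₀ , λ { F.zero → congruent₀ ; (F.suc i) → congruent-tail i }
  ungroup : ∀ {t} → t ≡ + r₀ mod n₀ × (∀ i → Congruent t i) →
            (t ≡ + r₀ mod n₀ × (∀ i → Congruent t (F.suc i))) × Congruent t F.zero
  ungroup (t≡r₀ , congruent) = (t≡r₀ , congruent ∘ F.suc) , congruent F.zero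

2∤2*n+1 : ∀ n → 2 ∤ 2 * n + 1
2∤2*n+1 n 2∣2n+1 = contradiction (∣1⇒≡1 (∣m+n∣m⇒∣n 2∣2n+1 (m∣m*n n))) λ ()

2∤⇒≡2*h+1 : ∀ {k} → 2 ∤ k → ∃ λ h → k ≡ 2 * h + 1
2∤⇒≡2*h+1 {zero}          2∤0   = contradiction (2 ∣0) 2∤0
2∤⇒≡2*h+1 {suc zero}      _     = 0 , refl
2∤⇒≡2*h+1 {suc (suc k)}   2∤2+k with 2∤⇒≡2*h+1 (2∤2+k ∘ ∣m∣n⇒∣m+n ∣-refl)
... | h , k≡2h+1 = suc h , trans (cong (_+_ 2) k≡2h+1) (shift h)
  where
  shift : ∀ h → 2 + (2 * h + 1) ≡ 2 * suc h + 1
  shift = ℕ-Ring.solve-∀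

2∤-* : ∀ {m n} → 2 ∤ m → 2 ∤ n → 2 ∤ m * n
2∤-* {m} {n} 2∤m 2∤n = [ 2∤m , 2∤n ] ∘ euclidsLemma m n prime[2]

∣m+n∣n⇒∣m : ∀ {d m n} → d ∣ℕ m + n → d ∣ℕ n → d ∣ℕ m
∣m+n∣n⇒∣m {d} {m} {n} d∣m+n = ∣m+n∣m⇒∣n (subst (d ∣ℕ_) (+-comm m n) d∣m+n)

2∤⇔≡1-mod-2 : ∀ {u} → 2 ∤ u ⇔ + u ≡ + 1 mod 2
2∤⇔≡1-mod-2 = mk⇔ to from
  where
  to : ∀ {u} → 2 ∤ u → + u ≡ + 1 mod 2
  to 2∤u with 2∤⇒≡2*h+1 2∤u
  ... | h , refl = Equivalence.to (∣∸⇔≡-mod (m≤n+m 1 (2 * h)))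
                     (subst (2 ∣ℕ_) (sym (m+n∸n≡m (2 * h) 1)) (m∣m*n h))
  from : ∀ {u} → + u ≡ + 1 mod 2 → 2 ∤ u
  from {u} (mk≡mod 2∣u-1) 2∣u = contradiction (∣1⇒≡1 (∣⇒∣ᵤ (subst (+ 2 ∣ₛ_) (cancel (+ u))
    (Signed.∣m∣n⇒∣m-n (∣ᵤ⇒∣ {+ 2} {+ u} 2∣u) 2∣u-1)))) λ ()
    where
    cancel : ∀ u → u ℤ.- (u ℤ.- + 1) ≡ + 1
    cancel = ℤ-Ring.solve-∀

prime⇒2∤ : ∀ {p} → Prime p → 2 < p → 2 ∤ p
prime⇒2∤ p-prime 2<p 2∣p = contradiction (prime⇒coprime p-prime 2<p (2∣p , ∣-refl)) λ ()

offset : ℕ → ℕ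
offset q = 4 * nearest q 6

2∣offset : ∀ q → 2 ∣ℕ offset q
2∣offset q = ∣m⇒∣m*n (nearest q 6) (divides 2 refl)

offset>0 : ∀ {q} → 3 ≤ q → 0 < offset q
offset>0 {q} 3≤q = ≤-trans (s≤s z≤n) (ℕₚ.*-monoʳ-≤ 4 nearest>0)
  where
  nearest>0 : 0 < nearest q 6
  nearest>0 = m≥n⇒m/n>0 (ℕₚ.+-monoˡ-≤ 6 (ℕₚ.*-monoʳ-≤ 2 3≤q))

3*offset≤2*q+6 : ∀ q → 3 * offset q ≤ 2 * q + 6
3*offset≤2*q+6 q = begin
  3 * (4 * nearest q 6)  ≡⟨ twelve (nearest q 6) ⟩
  nearest q 6 * 12       ≤⟨ m/n*n≤m (2 * q + 6) 12 ⟩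
  2 * q + 6              ∎
  where
  open ℕₚ.≤-Reasoning
  twelve : ∀ n → 3 * (4 * n) ≡ n * 12
  twelve = ℕ-Ring.solve-∀

offset<q : ∀ {q} → 5 ≤ q → offset q < q
offset<q (s≤s (s≤s (s≤s (s≤s (s≤s {n = zero} z≤n)))))             = ≤-refl
offset<q (s≤s (s≤s (s≤s (s≤s (s≤s {n = suc zero} z≤n)))))         = s≤s (s≤s (s≤s (s≤s (s≤s z≤n))))
offset<q {q} (s≤s (s≤s (s≤s (s≤s (s≤s {n = suc (suc _)} z≤n))))) =
  ℕₚ.*-cancelˡ-< 3 (offset q) q (begin-strict
    3 * offset q  ≤⟨ 3*offset≤2*q+6 q ⟩
    2 * q + 6     <⟨ ℕₚ.+-monoʳ-< (2 * q) 6<q ⟩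
    2 * q + q     ≡⟨ three q ⟩
    3 * q         ∎)
  where
  open ℕₚ.≤-Reasoning
  6<q : 6 < q
  6<q = s≤s (s≤s (s≤s (s≤s (s≤s (s≤s (s≤s z≤n))))))
  three : ∀ q → 2 * q + q ≡ 3 * q
  three = ℕ-Ring.solve-∀

module NonRanks {q : ℕ} (q-prime : Prime q) (5≤q : 5 ≤ q) where

  private
    c : ℕ
    c = offset q

    2<q : 2 < q
    2<q = ≤-trans (s≤s (s≤s (s≤s z≤n))) 5≤q

    c<q : c < q
    c<q = offset<q 5≤q

    2∣c : 2 ∣ℕ c
    2∣c = 2∣offset q

    c≤[2n+1]q : ∀ n → c ≤ (2 * n + 1) * q
    c≤[2n+1]q n = ≤-trans (<⇒≤ c<q) (m≤n*m q (2 * n + 1) {{>-nonZero (m≤n+m 1 (2 * n))}})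

    2∤[2n+1]q : ∀ n → 2 ∤ (2 * n + 1) * q
    2∤[2n+1]q n = 2∤-* (2∤2*n+1 n) (prime⇒2∤ q-prime 2<q)

    odd-cofactor : ∀ {v} k → 2 ∤ v → v ≡ k * q → ∃ λ h → k ≡ 2 * h + 1
    odd-cofactor k 2∤v v≡kq = 2∤⇒≡2*h+1 λ 2∣k → 2∤v (subst (2 ∣ℕ_) (sym v≡kq) (∣m⇒∣m*n q 2∣k))

  NonRankℕ : ℕ → Set
  NonRankℕ u = (∃ λ n → u ≡ (2 * n + 1) * q + c) ⊎ (∃ λ n → n ≥ 1 × u + c ≡ (2 * n + 1) * q)

  nonRank⇔nonRankℕ : ∀ {u} → NonRank q (+ u) ⇔ NonRankℕ u
  nonRank⇔nonRankℕ {u} = mk⇔ to from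
    where
    to : NonRank q (+ u) → NonRankℕ u
    to (inj₁ (n , u≡))        = inj₁ (n , +-injective u≡)
    to (inj₂ (n , n≥1 , u≡)) = inj₂ (n , n≥1 , (begin
      u + c                     ≡⟨ cong (_+ c) (+-injective (trans u≡ (+m-+n≡+[m∸n] (c≤[2n+1]q n)))) ⟩
      (2 * n + 1) * q ∸ c + c   ≡⟨ m∸n+n≡m (c≤[2n+1]q n) ⟩
      (2 * n + 1) * q           ∎))
      where open ≡-Reasoning
    from : NonRankℕ u → NonRank q (+ u)
    from (inj₁ (n , u≡))          = inj₁ (n , cong +_ u≡)
    from (inj₂ (n , n≥1 , u+c≡)) = inj₂ (n , n≥1 , (begin
      + u                           ≡⟨ cong +_ (m+n∸n≡m u c) ⟨
      + (u + c ∸ c)                 ≡⟨ cong (λ v → + (v ∸ c)) u+c≡ ⟩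
      + ((2 * n + 1) * q ∸ c)       ≡⟨ +m-+n≡+[m∸n] (c≤[2n+1]q n) ⟨
      + ((2 * n + 1) * q) ℤ.- + c   ∎))
      where open ≡-Reasoning

  nonRankℕ⇔ : ∀ {u} → q ≤ u → NonRankℕ u ⇔ (2 ∤ u × (q ∣ℕ u ∸ c ⊎ q ∣ℕ u + c))
  nonRankℕ⇔ {u} q≤u = mk⇔ to from
    where
    c≤u : c ≤ u
    c≤u = ≤-trans (<⇒≤ c<q) q≤u
    to : NonRankℕ u → 2 ∤ u × (q ∣ℕ u ∸ c ⊎ q ∣ℕ u + c)
    to (inj₁ (n , refl)) =
      (λ 2∣u → 2∤[2n+1]q n (∣m+n∣n⇒∣m 2∣u 2∣c)) ,
      inj₁ (subst (q ∣ℕ_) (sym (m+n∸n≡m _ c)) (n∣m*n (2 * n + 1)))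
    to (inj₂ (n , _ , u+c≡)) =
      (λ 2∣u → 2∤[2n+1]q n (subst (2 ∣ℕ_) u+c≡ (∣m∣n⇒∣m+n 2∣u 2∣c))) ,
      inj₂ (subst (q ∣ℕ_) (sym u+c≡) (n∣m*n (2 * n + 1)))
    from : 2 ∤ u × (q ∣ℕ u ∸ c ⊎ q ∣ℕ u + c) → NonRankℕ u
    from (2∤u , inj₁ (divides k u∸c≡kq)) with odd-cofactor k (λ 2∣u∸c → 2∤u (∣m∸n∣n⇒∣m 2 c≤u 2∣u∸c 2∣c)) u∸c≡kq
    ... | h , refl = inj₁ (h , trans (sym (m∸n+n≡m c≤u)) (cong (_+ c) u∸c≡kq))
    from (2∤u , inj₂ (divides k u+c≡kq)) with odd-cofactor k (λ 2∣u+c → 2∤u (∣m+n∣n⇒∣m 2∣u+c 2∣c)) u+c≡kq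
    ... | zero  , refl = contradiction (subst (u + c ≤_) (trans u+c≡kq (ℕₚ.+-identityʳ q)) ≤-refl)
                           (<⇒≱ (≤-<-trans q≤u (ℕₚ.m<m+n u (offset>0 2<q))))
    ... | suc h , refl = inj₂ (suc h , s≤s z≤n , u+c≡kq)

  nonRank⇔ : ∀ {u} → q ≤ u →
             NonRank q (+ u) ⇔ (+ u ≡ + 1 mod 2 × (+ u ≡ + c mod q ⊎ + u ≡ ℤ.- + c mod q))
  nonRank⇔ q≤u = ⇔.trans nonRank⇔nonRankℕ (⇔.trans (nonRankℕ⇔ q≤u)
    (2∤⇔≡1-mod-2 ×-⇔ (∣∸⇔≡-mod (≤-trans (<⇒≤ c<q) q≤u) ⊎-⇔ ∣+⇔≡-mod)))

  offset≢-offset : ¬ (+ c ≡ ℤ.- + c mod q)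
  offset≢-offset c≡-c with euclidsLemma 2 c q-prime (subst (q ∣ℕ_) c+c≡2*c (Equivalence.from ∣+⇔≡-mod c≡-c))
    where
    c+c≡2*c : c + c ≡ 2 * c
    c+c≡2*c = cong (_+_ c) (sym (ℕₚ.+-identityʳ c))
  ... | inj₁ q∣2 = <⇒≱ 2<q (∣⇒≤ q∣2)
  ... | inj₂ q∣c = <⇒≱ c<q (∣⇒≤ {{>-nonZero (offset>0 2<q)}} q∣c)

nonRanks⇔ : ∀ m (p : Fin (suc m) → ℕ) → (∀ i → Prime (p i)) → (∀ i → 5 ≤ p i) → ∀ {u} → (∀ i → p i ≤ u) →
  (∀ i → NonRank (p i) (+ u)) ⇔
  (+ u ≡ + 1 mod 2 × (∀ i → + u ≡ + offset (p i) mod p i ⊎ + u ≡ ℤ.- + offset (p i) mod p i))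
nonRanks⇔ m p p-prime 5≤p {u} p≤u = mk⇔
  (λ nonRank → proj₁ (Equivalence.to (single F.zero) (nonRank F.zero)) ,
               λ i → proj₂ (Equivalence.to (single i) (nonRank i)))
  (λ (odd , ±offset) i → Equivalence.from (single i) (odd , ±offset i))
  where
  single : ∀ i → NonRank (p i) (+ u) ⇔
    (+ u ≡ + 1 mod 2 × (+ u ≡ + offset (p i) mod p i ⊎ + u ≡ ℤ.- + offset (p i) mod p i))
  single i = NonRanks.nonRank⇔ (p-prime i) (5≤p i) (p≤u i)

theorem3p13 : (m : ℕ) → 1 ≤ m → (p : Fin m → ℕ) →
    (∀ i → Prime (p i)) → (∀ i → 5 ≤ p i) → (∀ i j → i F.< j → p i < p j) →
    Σ (List ℕ) λ rs →
      length rs ≡ 2 ^ m × Unique rs × All (λ r → r < 2 * prodFin m p) rs ×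
      ∃ λ (T : ℤ) → ∀ (t : ℤ) → T ℤ.≤ t →
        ((∀ i → NonRank (p i) t) ⇔
         (∃ λ r → r ∈ rs × (+ (2 * prodFin m p)) ∣ (t ℤ.- + r)))
theorem3p13 zero () p p-prime 5≤p p-increasing
theorem3p13 (suc m) _ p p-prime 5≤p p-increasing =
  residues , length-residues , residues-unique , residues-< , + P , nonRanks⇔residues
  where
  P : ℕ
  P = prodFin (suc m) p
  instance
    p≢0 : ∀ {i} → NonZero (p i)
    p≢0 {i} = prime⇒nonZero (p-prime i)
  p≤P : ∀ i → p i ≤ P
  p≤P i = ∣⇒≤ {{prodFin-nonZero (suc m) p λ _ → p≢0}} (∣-prodFin (suc m) p i)
  open ResidueClasses (crt-classes (suc m) p (λ i → + offset (p i)) (λ i → ℤ.- + offset (p i)) ≤-refl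
    (λ _ → p≢0)
    (λ i → Coprimality.sym (prime⇒coprime (p-prime i) (≤-trans (s≤s (s≤s (s≤s z≤n))) (5≤p i))))
    (λ i j i<j → Coprimality.sym (prime⇒coprime (p-prime j) (p-increasing i j i<j)))
    (λ i → NonRanks.offset≢-offset (p-prime i) (5≤p i)))
  nonRanks⇔residues : ∀ t → + P ℤ.≤ t →
    (∀ i → NonRank (p i) t) ⇔ (∃ λ r → r ∈ residues × + (2 * P) ∣ t ℤ.- + r)
  nonRanks⇔residues (+ u) (ℤ.+≤+ P≤u) =
    ⇔.trans (nonRanks⇔ m p p-prime 5≤p (λ i → ≤-trans (p≤P i) P≤u))
      (⇔.trans (characterisation (+ u))
        (mk⇔ (map₂ (map₂ (Equivalence.to ≡-mod⇔∣))) (map₂ (map₂ (Equivalence.from ≡-mod⇔∣)))))
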